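{- Let $k\ge0$, let $A,B$ be finite alphabets, and let $f:B^*\to A^*$ be a monoid homomorphism (possibly erasing, i.e. $f(b)$ may be the empty word). Let $w_1,w_2\in B^*$. If $w_1\equiv_k w_2$, then $f(w_1)\equiv_k f(w_2)$.
   Context: $FO^2[<,\mathrm{bet}]$ over an alphabet $C$: first-order logic over finite words using only two reusable variables, with $<$, unary predicates $c(x)$ (letter at $x$ is $c$) and binary predicates $c(x,y)$ ($c\in C$) meaning some position strictly between $x$ and $y$ carries $c$; sentences may be evaluated in the empty word, where existential sentences are false. For words $u,v$ over the same alphabet, $u\equiv_k v$ means that $u$ and $v$ satisfy exactly the same sentences of $FO^2[<,\mathrm{bet}]$ of quantifier depth at most $k$. -}

module Defs where

open import Data.Nat using (ℕ; zero; suc; _<_; _≤_; _⊔_)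
open import Data.Fin using (Fin)
open import Data.List using (List; []; _∷_; length; _++_)
open import Data.Maybe using (Maybe; just; nothing)
open import Data.Product using (_×_; ∃-syntax; _,_)
open import Data.Sum using (_⊎_)
open import Data.Empty using (⊥)
open import Relation.Nullary using (¬_)
open import Relation.Binary.PropositionalEquality using (_≡_)
open import Function.Bundles using (_⇔_)

Word : ℕ → Set
Word n = List (Fin n)

at : ∀ {n} → Word n → ℕ → Maybe (Fin n)
at []      _       = nothing
at (a ∷ w) zero    = just a
at (a ∷ w) (suc i) = at w i

data Var : Set where
  vx vy : Var

-- formulas of FO²[<, bet] over the alphabet Fin n
data Formula (n : ℕ) : Set where
  eqF   : Var → Var → Formula n
  ltF   : Var → Var → Formula n
  letF  : Fin n → Var → Formula n
  betF  : Fin n → Var → Var → Formula n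
  notF  : Formula n → Formula n
  andF  : Formula n → Formula n → Formula n
  orF   : Formula n → Formula n → Formula n
  exF   : Var → Formula n → Formula n
  allF  : Var → Formula n → Formula n

qd : ∀ {n} → Formula n → ℕ
qd (eqF _ _)    = 0
qd (ltF _ _)    = 0
qd (letF _ _)   = 0
qd (betF _ _ _) = 0
qd (notF φ)     = qd φ
qd (andF φ ψ)   = qd φ ⊔ qd ψ
qd (orF φ ψ)    = qd φ ⊔ qd ψ
qd (exF _ φ)    = suc (qd φ)
qd (allF _ φ)   = suc (qd φ)

data Free {n : ℕ} (v : Var) : Formula n → Set where
  eqˡ  : ∀ {u} → Free v (eqF v u)
  eqʳ  : ∀ {u} → Free v (eqF u v)
  ltˡ  : ∀ {u} → Free v (ltF v u)
  ltʳ  : ∀ {u} → Free v (ltF u v)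
  let₁ : ∀ {c} → Free v (letF c v)
  betˡ : ∀ {c u} → Free v (betF c v u)
  betʳ : ∀ {c u} → Free v (betF c u v)
  not₁ : ∀ {φ} → Free v φ → Free v (notF φ)
  andˡ : ∀ {φ ψ} → Free v φ → Free v (andF φ ψ)
  andʳ : ∀ {φ ψ} → Free v ψ → Free v (andF φ ψ)
  orˡ  : ∀ {φ ψ} → Free v φ → Free v (orF φ ψ)
  orʳ  : ∀ {φ ψ} → Free v ψ → Free v (orF φ ψ)
  ex₁  : ∀ {u φ} → ¬ (u ≡ v) → Free v φ → Free v (exF u φ)
  all₁ : ∀ {u φ} → ¬ (u ≡ v) → Free v φ → Free v (allF u φ)

Sentence : ∀ {n} → Formula n → Set
Sentence φ = ∀ v → ¬ Free v φ

Assignment : Set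
Assignment = Var → ℕ

update : Assignment → Var → ℕ → Assignment
update ρ vx i vx = i
update ρ vx i vy = ρ vy
update ρ vy i vx = ρ vx
update ρ vy i vy = i

Between : ℕ → ℕ → ℕ → Set
Between i j m = (i < m × m < j) ⊎ (j < m × m < i)

Sat : ∀ {n} → Word n → Assignment → Formula n → Set
Sat w ρ (eqF u v)    = ρ u ≡ ρ v
Sat w ρ (ltF u v)    = ρ u < ρ v
Sat w ρ (letF c v)   = at w (ρ v) ≡ just c
Sat w ρ (betF c u v) = ∃[ m ] (Between (ρ u) (ρ v) m × at w m ≡ just c)
Sat w ρ (notF φ)     = ¬ Sat w ρ φ
Sat w ρ (andF φ ψ)   = Sat w ρ φ × Sat w ρ ψ
Sat w ρ (orF φ ψ)    = Sat w ρ φ ⊎ Sat w ρ ψ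
Sat w ρ (exF v φ)    = ∃[ i ] (i < length w × Sat w (update ρ v i) φ)
Sat w ρ (allF v φ)   = ∀ i → i < length w → Sat w (update ρ v i) φ

-- a sentence holds in a word (the assignment is irrelevant for sentences;
-- we fix the all-zero one)
_⊨_ : ∀ {n} → Word n → Formula n → Set
w ⊨ φ = Sat w (λ _ → 0) φ

_≡[_]_ : ∀ {n} → Word n → ℕ → Word n → Set
u ≡[ k ] v = ∀ φ → Sentence φ → qd φ ≤ k → (u ⊨ φ ⇔ v ⊨ φ)

IsMonoidHom : ∀ {m n} → (Word m → Word n) → Set
IsMonoidHom f = (f [] ≡ []) × (∀ u v → f (u ++ v) ≡ f u ++ f v)

module Submission where

-- With L β = f [ β ], f w is concatMap L w, whose positions are the pairs (p, o) of a
-- position p of w and an offset o < |L (w p)|.  Hence a formula about f w, once each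
-- variable is given an offset, can be rewritten into a formula about w whose variables
-- range over the positions p: the offsets are bounded, so quantifying over them becomes
-- a finite disjunction or conjunction, and comparing them gives constants.  The rewriting
-- adds no quantifiers and no free variables, so the pullback of a sentence of depth ≤ k is
-- a sentence of depth ≤ k, and it holds in w iff the original holds in f w.

open import Defs
open import Level using (0ℓ)
open import Data.Nat using (ℕ; zero; suc; _+_; _∸_; _<_; _≤_; z≤n; s≤s; _<?_; _≟_)
open import Data.Nat.Properties
open import Data.Fin using (Fin) renaming (_≟_ to _≟ᶠ_)
open import Data.List using (List; []; _∷_; length; _++_; concatMap; allFin; upTo)
open import Data.List.Properties using (length-++)
open import Data.List.Relation.Unary.Any using (Any; here; there)
open import Data.List.Relation.Unary.All as All using (All; []; _∷_)
open import Data.List.Membership.Propositional using (find; lose)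
open import Data.List.Membership.Propositional.Properties using (∈-allFin; ∈-upTo⁺; ∈-upTo⁻)
open import Data.Maybe using (just)
open import Data.Maybe.Properties using (just-injective) renaming (≡-dec to ≡-dec-Maybe)
open import Data.Product using (_×_; ∃-syntax; _,_)
open import Data.Product.Relation.Binary.Lex.Strict using (×-Lex)
open import Data.Product.Function.NonDependent.Propositional using (_×-⇔_)
open import Data.Sum using (_⊎_; inj₁; inj₂; swap)
open import Data.Sum.Function.Propositional using (_⊎-⇔_)
open import Data.Empty using (⊥-elim)
open import Data.Unit using (⊤; tt)
open import Relation.Nullary using (¬_; Dec; yes; no; _×-dec_)
open import Relation.Binary using (Rel; tri<; tri≈; tri>)
open import Relation.Binary.PropositionalEquality
open import Function using (_∘_)
open import Function.Bundles using (_⇔_; mk⇔; Equivalence)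
open import Function.Properties.Equivalence using (⇔-setoid)
  renaming (refl to ⇔-refl; sym to ⇔-sym; trans to ⇔-trans)
open import Function.Related.TypeIsomorphisms using (¬-cong-⇔)
import Relation.Binary.Reasoning.Setoid as SetoidReasoning

open Equivalence using (to; from)
module ⇔-Reasoning = SetoidReasoning (⇔-setoid 0ℓ)

resp-⇔ : (R : ℕ → Set) {i i′ : ℕ} → i ≡ i′ → R i ⇔ R i′
resp-⇔ R refl = ⇔-refl

resp₂-⇔ : (R : ℕ → ℕ → Set) {i i′ j j′ : ℕ} → i ≡ i′ → j ≡ j′ → R i j ⇔ R i′ j′
resp₂-⇔ R refl refl = ⇔-refl

update-same : ∀ (ρ : Assignment) v i → update ρ v i v ≡ i
update-same ρ vx i = refl
update-same ρ vy i = refl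

∃-Between-⇔ : ∀ {i j} {A : ℕ → Set} →
  (∃[ m ] (Between i j m × A m)) ⇔ (∃[ m ] ((i < m × m < j) × A m) ⊎ ∃[ m ] ((j < m × m < i) × A m))
∃-Between-⇔ = mk⇔
  (λ { (m , inj₁ i<m<j , Am) → inj₁ (m , i<m<j , Am) ; (m , inj₂ j<m<i , Am) → inj₂ (m , j<m<i , Am) })
  (λ { (inj₁ (m , i<m<j , Am)) → m , inj₁ i<m<j , Am ; (inj₂ (m , j<m<i , Am)) → m , inj₂ j<m<i , Am })

at-just⇒< : ∀ {n} (u : Word n) i {c} → at u i ≡ just c → i < length u
at-just⇒< (x ∷ u) zero    e = s≤s z≤n
at-just⇒< (x ∷ u) (suc i) e = s≤s (at-just⇒< u i e)

<⇒at-just : ∀ {n} (u : Word n) i → i < length u → ∃[ c ] at u i ≡ just c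
<⇒at-just (x ∷ u) zero    _         = x , refl
<⇒at-just (x ∷ u) (suc i) (s≤s i<) = <⇒at-just u i i<

at-++ˡ : ∀ {n} (u v : Word n) i → i < length u → at (u ++ v) i ≡ at u i
at-++ˡ (x ∷ u) v zero    _         = refl
at-++ˡ (x ∷ u) v (suc i) (s≤s i<) = at-++ˡ u v i i<

at-++ʳ : ∀ {n} (u v : Word n) i → at (u ++ v) (length u + i) ≡ at v i
at-++ʳ []      v i = refl
at-++ʳ (x ∷ u) v i = at-++ʳ u v i

∃-at? : ∀ {n} {P : ℕ → Set} → (∀ j → Dec (P j)) → (u : Word n) (c : Fin n) →
        Dec (∃[ j ] (P j × at u j ≡ just c))
∃-at? P? []      c = no λ { (_ , _ , ()) }
∃-at? P? (x ∷ u) c with P? 0 ×-dec (x ≟ᶠ c) | ∃-at? (P? ∘ suc) u c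
... | yes (p0 , refl) | _                  = yes (0 , p0 , refl)
... | no _            | yes (j , pj , e)   = yes (suc j , pj , e)
... | no ¬here        | no ¬there          = no λ
  { (zero  , p0 , e) → ¬here (p0 , just-injective e)
  ; (suc j , pj , e) → ¬there (j , pj , e) }

module _ {n : ℕ} where

  ⊥F : Var → Formula n
  ⊥F z = notF (eqF z z)

  decF : {P : Set} → Var → Dec P → Formula n
  decF z (yes _) = eqF z z
  decF z (no _)  = ⊥F z

  ⋁ : {A : Set} → Var → List A → (A → Formula n) → Formula n
  ⋁ z []       F = ⊥F z
  ⋁ z (i ∷ is) F = orF (F i) (⋁ z is F)

  ⋀ : {A : Set} → Var → List A → (A → Formula n) → Formula n
  ⋀ z []       F = eqF z z
  ⋀ z (i ∷ is) F = andF (F i) (⋀ z is F)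

  module _ {w : Word n} {ρ : Assignment} where

    sat-decF : ∀ {P : Set} {z} (d : Dec P) → Sat w ρ (decF z d) ⇔ P
    sat-decF (yes p) = mk⇔ (λ _ → p) (λ _ → refl)
    sat-decF (no ¬p) = mk⇔ (λ ¬refl → ⊥-elim (¬refl refl)) (⊥-elim ∘ ¬p)

    sat-⋁ : ∀ {A : Set} {z} (is : List A) (F : A → Formula n) →
            Sat w ρ (⋁ z is F) ⇔ Any (λ i → Sat w ρ (F i)) is
    sat-⋁ []       F = mk⇔ (λ ¬refl → ⊥-elim (¬refl refl)) λ ()
    sat-⋁ (i ∷ is) F = mk⇔
      (λ { (inj₁ s) → here s ; (inj₂ s) → there (to (sat-⋁ is F) s) })
      (λ { (here s) → inj₁ s ; (there s) → inj₂ (from (sat-⋁ is F) s) })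

    sat-⋀ : ∀ {A : Set} {z} (is : List A) (F : A → Formula n) →
            Sat w ρ (⋀ z is F) ⇔ All (λ i → Sat w ρ (F i)) is
    sat-⋀ []       F = mk⇔ (λ _ → []) (λ _ → refl)
    sat-⋀ (i ∷ is) F = mk⇔
      (λ { (s , r) → s ∷ to (sat-⋀ is F) r })
      (λ { (s ∷ r) → s , from (sat-⋀ is F) r })

    sat-⋁-allFin : ∀ {z} m (F : Fin m → Formula n) →
                   Sat w ρ (⋁ z (allFin m) F) ⇔ (∃[ i ] Sat w ρ (F i))
    sat-⋁-allFin m F = ⇔-trans (sat-⋁ (allFin m) F)
      (mk⇔ (λ s → let i , _ , si = find s in i , si) (λ { (i , si) → lose (∈-allFin i) si }))

    sat-⋁-upTo : ∀ {z} m (F : ℕ → Formula n) →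
                 Sat w ρ (⋁ z (upTo m) F) ⇔ (∃[ o ] (o < m × Sat w ρ (F o)))
    sat-⋁-upTo m F = ⇔-trans (sat-⋁ (upTo m) F)
      (mk⇔ (λ s → let o , o∈ , so = find s in o , ∈-upTo⁻ o∈ , so)
           (λ { (o , o< , so) → lose (∈-upTo⁺ o<) so }))

    sat-⋀-allFin : ∀ {z} m (F : Fin m → Formula n) →
                   Sat w ρ (⋀ z (allFin m) F) ⇔ (∀ i → Sat w ρ (F i))
    sat-⋀-allFin m F = ⇔-trans (sat-⋀ (allFin m) F)
      (mk⇔ (λ s i → All.lookup s (∈-allFin i)) (λ s → All.tabulate (λ {i} _ → s i)))

    sat-⋀-upTo : ∀ {z} m (F : ℕ → Formula n) →
                 Sat w ρ (⋀ z (upTo m) F) ⇔ (∀ o → o < m → Sat w ρ (F o))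
    sat-⋀-upTo m F = ⇔-trans (sat-⋀ (upTo m) F)
      (mk⇔ (λ s o o< → All.lookup s (∈-upTo⁺ o<)) (λ s → All.tabulate (λ o∈ → s _ (∈-upTo⁻ o∈))))

  free-decF : ∀ {P : Set} {z u} (d : Dec P) → Free {n} u (decF z d) → u ≡ z
  free-decF (yes _) eqˡ        = refl
  free-decF (yes _) eqʳ        = refl
  free-decF (no _)  (not₁ eqˡ) = refl
  free-decF (no _)  (not₁ eqʳ) = refl

  free-⋁ : ∀ {A : Set} {z u} (is : List A) (F : A → Formula n) →
           Free u (⋁ z is F) → u ≡ z ⊎ ∃[ i ] Free u (F i)
  free-⋁ []       F (not₁ eqˡ) = inj₁ refl
  free-⋁ []       F (not₁ eqʳ) = inj₁ refl
  free-⋁ (i ∷ is) F (orˡ fr)   = inj₂ (i , fr)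
  free-⋁ (i ∷ is) F (orʳ fr)   = free-⋁ is F fr

  free-⋀ : ∀ {A : Set} {z u} (is : List A) (F : A → Formula n) →
           Free u (⋀ z is F) → u ≡ z ⊎ ∃[ i ] Free u (F i)
  free-⋀ []       F eqˡ        = inj₁ refl
  free-⋀ []       F eqʳ        = inj₁ refl
  free-⋀ (i ∷ is) F (andˡ fr)  = inj₂ (i , fr)
  free-⋀ (i ∷ is) F (andʳ fr)  = free-⋀ is F fr

  qd-decF : ∀ {P : Set} {z k} (d : Dec P) → qd {n} (decF z d) ≤ k
  qd-decF (yes _) = z≤n
  qd-decF (no _)  = z≤n

  qd-⋁ : ∀ {A : Set} {z k} (is : List A) (F : A → Formula n) →
         (∀ i → qd (F i) ≤ k) → qd (⋁ z is F) ≤ k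
  qd-⋁ []       F h = z≤n
  qd-⋁ (i ∷ is) F h = ⊔-lub (h i) (qd-⋁ is F h)

  qd-⋀ : ∀ {A : Set} {z k} (is : List A) (F : A → Formula n) →
         (∀ i → qd (F i) ≤ k) → qd (⋀ z is F) ≤ k
  qd-⋀ []       F h = z≤n
  qd-⋀ (i ∷ is) F h = ⊔-lub (h i) (qd-⋀ is F h)

_<ₗ_ : Rel (ℕ × ℕ) 0ℓ
_<ₗ_ = ×-Lex _≡_ _<_ _<_

module Blocks {a b : ℕ} (L : Fin b → Word a) where

  blockStart : Word b → ℕ → ℕ
  blockStart []      _       = 0
  blockStart (x ∷ w) zero    = 0
  blockStart (x ∷ w) (suc p) = length (L x) + blockStart w p

  InBlock : Word b → ℕ → ℕ → Set
  InBlock w p o = ∃[ β ] (at w p ≡ just β × o < length (L β))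

  Occurs : Fin a → Fin b → (ℕ → Set) → Set
  Occurs c β P = ∃[ j ] (P j × at (L β) j ≡ just c)

  blockStart-zero : ∀ w → blockStart w 0 ≡ 0
  blockStart-zero []      = refl
  blockStart-zero (x ∷ w) = refl

  blockStart-suc : ∀ w p {β} → at w p ≡ just β → blockStart w (suc p) ≡ blockStart w p + length (L β)
  blockStart-suc (x ∷ w) zero    refl = trans (cong (length (L x) +_) (blockStart-zero w)) (+-identityʳ _)
  blockStart-suc (x ∷ w) (suc p) {β} e =
    trans (cong (length (L x) +_) (blockStart-suc w p e))
          (sym (+-assoc (length (L x)) (blockStart w p) (length (L β))))

  blockStart-mono-≤ : ∀ w {p q} → p ≤ q → blockStart w p ≤ blockStart w q
  blockStart-mono-≤ []      _                  = z≤n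
  blockStart-mono-≤ (x ∷ w) {zero}  _          = z≤n
  blockStart-mono-≤ (x ∷ w) {suc p} (s≤s p≤q) = +-monoʳ-≤ (length (L x)) (blockStart-mono-≤ w p≤q)

  at-concatMap : ∀ w p o {β} → at w p ≡ just β → o < length (L β) →
                 at (concatMap L w) (blockStart w p + o) ≡ at (L β) o
  at-concatMap (x ∷ w) zero    o refl o< = at-++ˡ (L x) (concatMap L w) o o<
  at-concatMap (x ∷ w) (suc p) o e    o< = begin
    at (L x ++ concatMap L w) ((length (L x) + blockStart w p) + o)
      ≡⟨ cong (at (L x ++ concatMap L w)) (+-assoc (length (L x)) (blockStart w p) o) ⟩
    at (L x ++ concatMap L w) (length (L x) + (blockStart w p + o))  ≡⟨ at-++ʳ (L x) (concatMap L w) _ ⟩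
    at (concatMap L w) (blockStart w p + o)                          ≡⟨ at-concatMap w p o e o< ⟩
    at (L _) o                                                  ∎
    where open ≡-Reasoning

  inBlock⇒< : ∀ w {p o} → InBlock w p o → blockStart w p + o < length (concatMap L w)
  inBlock⇒< w {p} {o} (β , e , o<) =
    let c , eo = <⇒at-just (L β) o o< in
    at-just⇒< (concatMap L w) _ (trans (at-concatMap w p o e o<) eo)

  <⇒inBlock : ∀ w i → i < length (concatMap L w) → ∃[ p ] ∃[ o ] (InBlock w p o × i ≡ blockStart w p + o)
  <⇒inBlock (x ∷ w) i i< with i <? length (L x)
  ... | yes i<x = 0 , i , (x , refl , i<x) , refl
  ... | no i≮x with <⇒inBlock w (i ∸ length (L x)) (+-cancelˡ-< (length (L x)) _ _ i-x<)
    where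
      i-x< : length (L x) + (i ∸ length (L x)) < length (L x) + length (concatMap L w)
      i-x< = subst₂ _<_ (sym (m+[n∸m]≡n (≮⇒≥ i≮x))) (length-++ (L x)) i<
  ... | p , o , inBlock , eq = suc p , o , inBlock , (begin
    i                                        ≡⟨ m+[n∸m]≡n (≮⇒≥ i≮x) ⟨
    length (L x) + (i ∸ length (L x))        ≡⟨ cong (length (L x) +_) eq ⟩
    length (L x) + (blockStart w p + o)           ≡⟨ +-assoc (length (L x)) (blockStart w p) o ⟨
    length (L x) + blockStart w p + o             ∎)
    where open ≡-Reasoning

  ∃-position : ∀ w {P : ℕ → Set} →
               (∃[ i ] (i < length (concatMap L w) × P i)) ⇔
               (∃[ p ] ∃[ o ] (InBlock w p o × P (blockStart w p + o)))
  ∃-position w {P} = mk⇔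
    (λ { (i , i< , Pi) → let p , o , inBlock , eq = <⇒inBlock w i i< in p , o , inBlock , subst P eq Pi })
    (λ { (p , o , inBlock , Pi) → _ , inBlock⇒< w inBlock , Pi })

  ∀-position : ∀ w {P : ℕ → Set} →
               (∀ i → i < length (concatMap L w) → P i) ⇔ (∀ p o → InBlock w p o → P (blockStart w p + o))
  ∀-position w {P} = mk⇔
    (λ h p o inBlock → h _ (inBlock⇒< w inBlock))
    (λ h i i< → let p , o , inBlock , eq = <⇒inBlock w i i< in subst P (sym eq) (h p o inBlock))

  blockStart-<-lex : ∀ w {p o q o′} → InBlock w p o → (p , o) <ₗ (q , o′) →
                     blockStart w p + o < blockStart w q + o′
  blockStart-<-lex w {p} {o} {q} {o′} (β , e , o<) (inj₁ p<q) = begin-strict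
    blockStart w p + o                 <⟨ +-monoʳ-< (blockStart w p) o< ⟩
    blockStart w p + length (L β)      ≡⟨ blockStart-suc w p e ⟨
    blockStart w (suc p)               ≤⟨ blockStart-mono-≤ w p<q ⟩
    blockStart w q                     ≤⟨ m≤m+n (blockStart w q) o′ ⟩
    blockStart w q + o′                ∎
    where open ≤-Reasoning
  blockStart-<-lex w {p} _ (inj₂ (refl , o<o′)) = +-monoʳ-< (blockStart w p) o<o′

  blockStart-<-⇔ : ∀ w {p o q o′} → InBlock w p o → InBlock w q o′ →
              (blockStart w p + o < blockStart w q + o′) ⇔ ((p , o) <ₗ (q , o′))
  blockStart-<-⇔ w {p} {o} {q} {o′} inP inQ = mk⇔ lex (blockStart-<-lex w inP)
    where
      lex : blockStart w p + o < blockStart w q + o′ → (p , o) <ₗ (q , o′)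
      lex s< with <-cmp p q
      ... | tri< p<q _ _ = inj₁ p<q
      ... | tri≈ _ refl _ = inj₂ (refl , +-cancelˡ-< (blockStart w p) o o′ s<)
      ... | tri> _ _ q<p = ⊥-elim (<-asym s< (blockStart-<-lex w inQ (inj₁ q<p)))

  blockStart-≡-⇔ : ∀ w {p o q o′} → InBlock w p o → InBlock w q o′ →
              (blockStart w p + o ≡ blockStart w q + o′) ⇔ (p ≡ q × o ≡ o′)
  blockStart-≡-⇔ w {p} {o} {q} {o′} inP inQ = mk⇔ eq (λ { (refl , refl) → refl })
    where
      eq : blockStart w p + o ≡ blockStart w q + o′ → p ≡ q × o ≡ o′
      eq s≡ with <-cmp p q
      ... | tri< p<q _ _ = ⊥-elim (<-irrefl s≡ (blockStart-<-lex w inP (inj₁ p<q)))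
      ... | tri≈ _ refl _ = refl , +-cancelˡ-≡ (blockStart w p) o o′ s≡
      ... | tri> _ _ q<p = ⊥-elim (<-irrefl (sym s≡) (blockStart-<-lex w inQ (inj₁ q<p)))

  OccursLexBetween : Fin a → Word b → ℕ → ℕ → ℕ → ℕ → Set
  OccursLexBetween c w p ou q ov =
    ∃[ r ] ∃[ β ] (at w r ≡ just β × Occurs c β (λ j → (p , ou) <ₗ (r , j) × (r , j) <ₗ (q , ov)))

  ∃-between⇔occursLexBetween : ∀ w c {p ou q ov} → InBlock w p ou → InBlock w q ov →
    (∃[ m ] ((blockStart w p + ou < m × m < blockStart w q + ov) × at (concatMap L w) m ≡ just c))
    ⇔ OccursLexBetween c w p ou q ov
  ∃-between⇔occursLexBetween w c {p} {ou} {q} {ov} inP inQ = mk⇔ split join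
    where
      split : (∃[ m ] ((blockStart w p + ou < m × m < blockStart w q + ov) × at (concatMap L w) m ≡ just c)) →
              OccursLexBetween c w p ou q ov
      split (m , (P<m , m<Q) , e) with <⇒inBlock w m (at-just⇒< (concatMap L w) m e)
      ... | r , j , inR@(β , eβ , j<) , refl =
        r , β , eβ , j , (to (blockStart-<-⇔ w inP inR) P<m , to (blockStart-<-⇔ w inR inQ) m<Q) ,
        trans (sym (at-concatMap w r j eβ j<)) e
      join : OccursLexBetween c w p ou q ov →
             ∃[ m ] ((blockStart w p + ou < m × m < blockStart w q + ov) × at (concatMap L w) m ≡ just c)
      join (r , β , eβ , j , (pou<rj , rj<qov) , e) =
        blockStart w r + j , (blockStart-<-lex w inP pou<rj , blockStart-<-lex w (β , eβ , j<) rj<qov) ,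
        trans (at-concatMap w r j eβ j<) e
        where j< = at-just⇒< (L β) j e

  OccursBetween : Fin a → Word b → ℕ → ℕ → ℕ → ℕ → Set
  OccursBetween c w p ou q ov =
      (p < q × ((∃[ β ] ((∃[ r ] (Between p q r × at w r ≡ just β)) × Occurs c β (λ _ → ⊤)))
               ⊎ (∃[ β ] (at w p ≡ just β × Occurs c β (ou <_)))
               ⊎ (∃[ β ] (at w q ≡ just β × Occurs c β (_< ov)))))
    ⊎ (p ≡ q × ∃[ β ] (at w p ≡ just β × Occurs c β (λ j → ou < j × j < ov)))

  occursLexBetween⇔occursBetween : ∀ c w {p ou q ov} →
    OccursLexBetween c w p ou q ov
    ⇔ OccursBetween c w p ou q ov
  occursLexBetween⇔occursBetween c w {p} {ou} {q} {ov} = mk⇔ classify witness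
    where
      classify : OccursLexBetween c w p ou q ov → OccursBetween c w p ou q ov
      classify (r , β , eβ , j , (inj₁ p<r , inj₁ r<q) , e) =
        inj₁ (<-trans p<r r<q , inj₁ (β , (r , inj₁ (p<r , r<q) , eβ) , j , tt , e))
      classify (r , β , eβ , j , (inj₂ (refl , ou<j) , inj₁ r<q) , e) =
        inj₁ (r<q , inj₂ (inj₁ (β , eβ , j , ou<j , e)))
      classify (r , β , eβ , j , (inj₁ p<r , inj₂ (refl , j<ov)) , e) =
        inj₁ (p<r , inj₂ (inj₂ (β , eβ , j , j<ov , e)))
      classify (r , β , eβ , j , (inj₂ (refl , ou<j) , inj₂ (refl , j<ov)) , e) =
        inj₂ (refl , β , eβ , j , (ou<j , j<ov) , e)

      witness : OccursBetween c w p ou q ov → OccursLexBetween c w p ou q ov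
      witness (inj₁ (p<q , inj₁ (β , (r , inj₁ (p<r , r<q) , eβ) , j , _ , e))) =
        r , β , eβ , j , (inj₁ p<r , inj₁ r<q) , e
      witness (inj₁ (p<q , inj₁ (_ , (_ , inj₂ (q<r , r<p) , _) , _))) = ⊥-elim (<-asym p<q (<-trans q<r r<p))
      witness (inj₁ (p<q , inj₂ (inj₁ (β , eβ , j , ou<j , e)))) =
        p , β , eβ , j , (inj₂ (refl , ou<j) , inj₁ p<q) , e
      witness (inj₁ (p<q , inj₂ (inj₂ (β , eβ , j , j<ov , e)))) =
        q , β , eβ , j , (inj₁ p<q , inj₂ (refl , j<ov)) , e
      witness (inj₂ (refl , β , eβ , j , (ou<j , j<ov) , e)) =
        p , β , eβ , j , (inj₂ (refl , ou<j) , inj₂ (refl , j<ov)) , e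

  ∃-between⇔occursBetween : ∀ w c {p ou q ov} → InBlock w p ou → InBlock w q ov →
    (∃[ m ] ((blockStart w p + ou < m × m < blockStart w q + ov) × at (concatMap L w) m ≡ just c))
    ⇔ OccursBetween c w p ou q ov
  ∃-between⇔occursBetween w c inP inQ =
    ⇔-trans (∃-between⇔occursLexBetween w c inP inQ) (occursLexBetween⇔occursBetween c w)

  at-concatMap-⇔ : ∀ w c {p o} → InBlock w p o →
    (at (concatMap L w) (blockStart w p + o) ≡ just c) ⇔ (∃[ β ] (at w p ≡ just β × Occurs c β (_≡ o)))
  at-concatMap-⇔ w c {p} {o} (β , eβ , o<) = mk⇔
    (λ e → β , eβ , o , refl , trans (sym (at-concatMap w p o eβ o<)) e)
    (λ { (β′ , eβ′ , _ , refl , e) → trans (at-concatMap w p o eβ′ (at-just⇒< (L β′) o e)) e })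

module Pullback {a b : ℕ} (L : Fin b → Word a) where
  open Blocks L

  someBlock : Var → (Fin b → Formula b) → Fin a → {P : ℕ → Set} → (∀ j → Dec (P j)) → Formula b
  someBlock z S c P? = ⋁ z (allFin b) (λ β → andF (S β) (decF z (∃-at? P? (L β) c)))

  blockAt : Var → Fin a → {P : ℕ → Set} → (∀ j → Dec (P j)) → Formula b
  blockAt z c P? = someBlock z (λ β → letF β z) c P?

  between : Fin a → Var → Var → ℕ → ℕ → Formula b
  between c x y ox oy =
    orF (andF (ltF x y) (orF (someBlock x (λ β → betF β x y) c (λ _ → yes tt))
                        (orF (blockAt x c (ox <?_)) (blockAt y c (_<? oy)))))
        (andF (eqF x y) (blockAt x c (λ j → (ox <? j) ×-dec (j <? oy))))

  ∃-slot : Var → (ℕ → Formula b) → Formula b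
  ∃-slot v ψ =
    exF v (⋁ v (allFin b) λ β → ⋁ v (upTo (length (L β))) λ o → andF (letF β v) (ψ o))

  ∀-slot : Var → (ℕ → Formula b) → Formula b
  ∀-slot v ψ =
    allF v (⋀ v (allFin b) λ β → ⋀ v (upTo (length (L β))) λ o → orF (notF (letF β v)) (ψ o))

  -- Variables of pullback φ σ range over positions of w, σ holds their offsets (fixed
  -- when the formula is built, so tests on offsets are decided into constants by decF).
  pullback : Formula a → Assignment → Formula b
  pullback (eqF x y)    σ = andF (eqF x y) (decF x (σ x ≟ σ y))
  pullback (ltF x y)    σ = orF (ltF x y) (andF (eqF x y) (decF x (σ x <? σ y)))
  pullback (letF c x)   σ = blockAt x c (_≟ σ x)
  pullback (betF c x y) σ = orF (between c x y (σ x) (σ y)) (between c y x (σ y) (σ x))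
  pullback (notF φ)     σ = notF (pullback φ σ)
  pullback (andF φ ψ)   σ = andF (pullback φ σ) (pullback ψ σ)
  pullback (orF φ ψ)    σ = orF (pullback φ σ) (pullback ψ σ)
  pullback (exF v φ)    σ = ∃-slot v (λ o → pullback φ (update σ v o))
  pullback (allF v φ)   σ = ∀-slot v (λ o → pullback φ (update σ v o))

  qd-someBlock : ∀ {z S c k} {P : ℕ → Set} (P? : ∀ j → Dec (P j)) →
                 (∀ β → qd (S β) ≤ k) → qd (someBlock z S c P?) ≤ k
  qd-someBlock {c = c} P? h = qd-⋁ (allFin b) _ (λ β → ⊔-lub (h β) (qd-decF (∃-at? P? (L β) c)))

  qd-between : ∀ c x y ox oy → qd (between c x y ox oy) ≤ 0
  qd-between c x y ox oy =
    ⊔-lub (⊔-lub (qd-someBlock _ (λ _ → z≤n))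
                 (⊔-lub (qd-someBlock _ (λ _ → z≤n)) (qd-someBlock _ (λ _ → z≤n))))
          (qd-someBlock _ (λ _ → z≤n))

  qd-pullback : ∀ φ σ → qd (pullback φ σ) ≤ qd φ
  qd-pullback (eqF x y)    σ = qd-decF (σ x ≟ σ y)
  qd-pullback (ltF x y)    σ = qd-decF (σ x <? σ y)
  qd-pullback (letF c x)   σ = qd-someBlock _ (λ _ → z≤n)
  qd-pullback (betF c x y) σ = ⊔-lub (qd-between c x y (σ x) (σ y)) (qd-between c y x (σ y) (σ x))
  qd-pullback (notF φ)     σ = qd-pullback φ σ
  qd-pullback (andF φ ψ)   σ = ⊔-mono-≤ (qd-pullback φ σ) (qd-pullback ψ σ)
  qd-pullback (orF φ ψ)    σ = ⊔-mono-≤ (qd-pullback φ σ) (qd-pullback ψ σ)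
  qd-pullback (exF v φ)    σ =
    s≤s (qd-⋁ (allFin b) _ λ β → qd-⋁ (upTo (length (L β))) _ λ o → qd-pullback φ (update σ v o))
  qd-pullback (allF v φ)   σ =
    s≤s (qd-⋀ (allFin b) _ λ β → qd-⋀ (upTo (length (L β))) _ λ o → qd-pullback φ (update σ v o))

  free-someBlock : ∀ {z S c u} {P : ℕ → Set} (P? : ∀ j → Dec (P j)) →
                   Free u (someBlock z S c P?) → u ≡ z ⊎ ∃[ β ] Free u (S β)
  free-someBlock {c = c} P? fr with free-⋁ (allFin b) _ fr
  ... | inj₁ u≡z               = inj₁ u≡z
  ... | inj₂ (β , andˡ fr′)    = inj₂ (β , fr′)
  ... | inj₂ (β , andʳ fr′)    = inj₁ (free-decF (∃-at? P? (L β) c) fr′)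

  free-blockAt : ∀ {z c u} {P : ℕ → Set} (P? : ∀ j → Dec (P j)) → Free u (blockAt z c P?) → u ≡ z
  free-blockAt P? fr with free-someBlock P? fr
  ... | inj₁ u≡z         = u≡z
  ... | inj₂ (_ , let₁)  = refl

  free-between : ∀ {u} c x y ox oy → Free u (between c x y ox oy) → u ≡ x ⊎ u ≡ y
  free-between c x y ox oy (orˡ (andˡ ltˡ))                 = inj₁ refl
  free-between c x y ox oy (orˡ (andˡ ltʳ))                 = inj₂ refl
  free-between c x y ox oy (orˡ (andʳ (orˡ fr))) with free-someBlock _ fr
  ... | inj₁ u≡x          = inj₁ u≡x
  ... | inj₂ (_ , betˡ)   = inj₁ refl
  ... | inj₂ (_ , betʳ)   = inj₂ refl
  free-between c x y ox oy (orˡ (andʳ (orʳ (orˡ fr))))      = inj₁ (free-blockAt _ fr)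
  free-between c x y ox oy (orˡ (andʳ (orʳ (orʳ fr))))      = inj₂ (free-blockAt _ fr)
  free-between c x y ox oy (orʳ (andˡ eqˡ))                 = inj₁ refl
  free-between c x y ox oy (orʳ (andˡ eqʳ))                 = inj₂ refl
  free-between c x y ox oy (orʳ (andʳ fr))                  = inj₁ (free-blockAt _ fr)

  free-∃-slot : ∀ {u} v ψ → Free u (∃-slot v ψ) → ¬ v ≡ u × ∃[ o ] Free u (ψ o)
  free-∃-slot v ψ (ex₁ v≢u fr) with free-⋁ (allFin b) _ fr
  ... | inj₁ u≡v = ⊥-elim (v≢u (sym u≡v))
  ... | inj₂ (β , fr′) with free-⋁ (upTo (length (L β))) _ fr′
  ...   | inj₁ u≡v             = ⊥-elim (v≢u (sym u≡v))
  ...   | inj₂ (_ , andˡ let₁) = ⊥-elim (v≢u refl)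
  ...   | inj₂ (o , andʳ fr″)  = v≢u , o , fr″

  free-∀-slot : ∀ {u} v ψ → Free u (∀-slot v ψ) → ¬ v ≡ u × ∃[ o ] Free u (ψ o)
  free-∀-slot v ψ (all₁ v≢u fr) with free-⋀ (allFin b) _ fr
  ... | inj₁ u≡v = ⊥-elim (v≢u (sym u≡v))
  ... | inj₂ (β , fr′) with free-⋀ (upTo (length (L β))) _ fr′
  ...   | inj₁ u≡v                    = ⊥-elim (v≢u (sym u≡v))
  ...   | inj₂ (_ , orˡ (not₁ let₁))  = ⊥-elim (v≢u refl)
  ...   | inj₂ (o , orʳ fr″)          = v≢u , o , fr″

  free-bet : ∀ {u c x y} → u ≡ x ⊎ u ≡ y → Free {a} u (betF c x y)
  free-bet (inj₁ refl) = betˡ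
  free-bet (inj₂ refl) = betʳ

  free-pullback : ∀ φ σ {u} → Free u (pullback φ σ) → Free u φ
  free-pullback (eqF x y)    σ (andˡ eqˡ)  = eqˡ
  free-pullback (eqF x y)    σ (andˡ eqʳ)  = eqʳ
  free-pullback (eqF x y)    σ (andʳ fr) with free-decF (σ x ≟ σ y) fr
  ... | refl = eqˡ
  free-pullback (ltF x y)    σ (orˡ ltˡ)   = ltˡ
  free-pullback (ltF x y)    σ (orˡ ltʳ)   = ltʳ
  free-pullback (ltF x y)    σ (orʳ (andˡ eqˡ)) = ltˡ
  free-pullback (ltF x y)    σ (orʳ (andˡ eqʳ)) = ltʳ
  free-pullback (ltF x y)    σ (orʳ (andʳ fr)) with free-decF (σ x <? σ y) fr
  ... | refl = ltˡ
  free-pullback (letF c x)   σ fr with free-blockAt _ fr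
  ... | refl = let₁
  free-pullback (betF c x y) σ (orˡ fr)    = free-bet (free-between c x y (σ x) (σ y) fr)
  free-pullback (betF c x y) σ (orʳ fr)    = free-bet (swap (free-between c y x (σ y) (σ x) fr))
  free-pullback (notF φ)     σ (not₁ fr)   = not₁ (free-pullback φ σ fr)
  free-pullback (andF φ ψ)   σ (andˡ fr)   = andˡ (free-pullback φ σ fr)
  free-pullback (andF φ ψ)   σ (andʳ fr)   = andʳ (free-pullback ψ σ fr)
  free-pullback (orF φ ψ)    σ (orˡ fr)    = orˡ (free-pullback φ σ fr)
  free-pullback (orF φ ψ)    σ (orʳ fr)    = orʳ (free-pullback ψ σ fr)
  free-pullback (exF v φ)    σ fr with free-∃-slot v _ fr
  ... | v≢u , o , fr′ = ex₁ v≢u (free-pullback φ (update σ v o) fr′)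
  free-pullback (allF v φ)   σ fr with free-∀-slot v _ fr
  ... | v≢u , o , fr′ = all₁ v≢u (free-pullback φ (update σ v o) fr′)

  sentence-pullback : ∀ {φ} σ → Sentence φ → Sentence (pullback φ σ)
  sentence-pullback {φ} σ closed u = closed u ∘ free-pullback φ σ

  module _ (w : Word b) where

    at-update-same : ∀ ρ v p → at w (update ρ v p v) ≡ at w p
    at-update-same ρ v p = cong (at w) (update-same ρ v p)

    sat-someBlock : ∀ {ρ z S c} {P : ℕ → Set} (P? : ∀ j → Dec (P j)) →
                    Sat w ρ (someBlock z S c P?) ⇔ (∃[ β ] (Sat w ρ (S β) × Occurs c β P))
    sat-someBlock {c = c} P? = ⇔-trans (sat-⋁-allFin b _) (mk⇔
      (λ { (β , s , d) → β , s , to (sat-decF (∃-at? P? (L β) c)) d })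
      (λ { (β , s , occ) → β , s , from (sat-decF (∃-at? P? (L β) c)) occ }))

    sat-between : ∀ {ρ} c x y ox oy →
                  Sat w ρ (between c x y ox oy) ⇔ OccursBetween c w (ρ x) ox (ρ y) oy
    sat-between c x y ox oy =
          (⇔-refl ×-⇔ (sat-someBlock _ ⊎-⇔ (sat-someBlock _ ⊎-⇔ sat-someBlock _)))
      ⊎-⇔ (⇔-refl ×-⇔ sat-someBlock _)

    sat-∃-slot : ∀ {ρ} v ψ →
                 Sat w ρ (∃-slot v ψ) ⇔ (∃[ p ] ∃[ o ] (InBlock w p o × Sat w (update ρ v p) (ψ o)))
    sat-∃-slot {ρ} v ψ = mk⇔ slot unslot
      where
        slot : Sat w ρ (∃-slot v ψ) → ∃[ p ] ∃[ o ] (InBlock w p o × Sat w (update ρ v p) (ψ o))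
        slot (p , _ , s) with to (sat-⋁-allFin b _) s
        ... | β , s′ with to (sat-⋁-upTo (length (L β)) _) s′
        ...   | o , o< , eβ , sψ = p , o , (β , trans (sym (at-update-same ρ v p)) eβ , o<) , sψ
        unslot : (∃[ p ] ∃[ o ] (InBlock w p o × Sat w (update ρ v p) (ψ o))) → Sat w ρ (∃-slot v ψ)
        unslot (p , o , (β , eβ , o<) , sψ) =
          p , at-just⇒< w p eβ , from (sat-⋁-allFin b _) (β , from (sat-⋁-upTo (length (L β)) _)
            (o , o< , trans (at-update-same ρ v p) eβ , sψ))

    sat-∀-slot : ∀ {ρ} v ψ →
                 Sat w ρ (∀-slot v ψ) ⇔ (∀ p o → InBlock w p o → Sat w (update ρ v p) (ψ o))
    sat-∀-slot {ρ} v ψ = mk⇔ slot unslot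
      where
        slot : Sat w ρ (∀-slot v ψ) → ∀ p o → InBlock w p o → Sat w (update ρ v p) (ψ o)
        slot h p o (β , eβ , o<)
          with to (sat-⋀-upTo (length (L β)) _) (to (sat-⋀-allFin b _) (h p (at-just⇒< w p eβ)) β) o o<
        ... | inj₁ ¬eβ = ⊥-elim (¬eβ (trans (at-update-same ρ v p) eβ))
        ... | inj₂ sψ  = sψ
        unslot : (∀ p o → InBlock w p o → Sat w (update ρ v p) (ψ o)) → Sat w ρ (∀-slot v ψ)
        unslot h p _ = from (sat-⋀-allFin b _) λ β → from (sat-⋀-upTo (length (L β)) _) λ o o< →
          case-letter β o o< (≡-dec-Maybe _≟ᶠ_ (at w p) (just β))
          where
            case-letter : ∀ β o → o < length (L β) → Dec (at w p ≡ just β) →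
                          Sat w (update ρ v p) (orF (notF (letF β v)) (ψ o))
            case-letter β o o< (yes eβ) = inj₂ (h p o (β , eβ , o<))
            case-letter β o o< (no ¬eβ) = inj₁ (¬eβ ∘ trans (sym (at-update-same ρ v p)))

    sat-exF : ∀ {ρ ρ′} v φ ψ →
              (∀ p o → InBlock w p o →
                 Sat (concatMap L w) (update ρ′ v (blockStart w p + o)) φ ⇔ Sat w (update ρ v p) (ψ o)) →
              Sat (concatMap L w) ρ′ (exF v φ) ⇔ Sat w ρ (∃-slot v ψ)
    sat-exF {ρ} {ρ′} v φ ψ IH = begin
      Sat (concatMap L w) ρ′ (exF v φ)
        ≈⟨ ∃-position w ⟩
      (∃[ p ] ∃[ o ] (InBlock w p o × Sat (concatMap L w) (update ρ′ v (blockStart w p + o)) φ))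
        ≈⟨ mk⇔ (λ { (p , o , inP , s) → p , o , inP , to (IH p o inP) s })
               (λ { (p , o , inP , s) → p , o , inP , from (IH p o inP) s }) ⟩
      (∃[ p ] ∃[ o ] (InBlock w p o × Sat w (update ρ v p) (ψ o)))
        ≈⟨ ⇔-sym (sat-∃-slot v ψ) ⟩
      Sat w ρ (∃-slot v ψ) ∎
      where open ⇔-Reasoning

    sat-allF : ∀ {ρ ρ′} v φ ψ →
               (∀ p o → InBlock w p o →
                  Sat (concatMap L w) (update ρ′ v (blockStart w p + o)) φ ⇔ Sat w (update ρ v p) (ψ o)) →
               Sat (concatMap L w) ρ′ (allF v φ) ⇔ Sat w ρ (∀-slot v ψ)
    sat-allF {ρ} {ρ′} v φ ψ IH = begin
      Sat (concatMap L w) ρ′ (allF v φ)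
        ≈⟨ ∀-position w ⟩
      (∀ p o → InBlock w p o →
         Sat (concatMap L w) (update ρ′ v (blockStart w p + o)) φ)
        ≈⟨ mk⇔ (λ h p o inP → to (IH p o inP) (h p o inP)) (λ h p o inP → from (IH p o inP) (h p o inP)) ⟩
      (∀ p o → InBlock w p o →
         Sat w (update ρ v p) (ψ o))
        ≈⟨ ⇔-sym (sat-∀-slot v ψ) ⟩
      Sat w ρ (∀-slot v ψ) ∎
      where open ⇔-Reasoning

    sat-betF : ∀ {ρ′ ρ σ} c x y → InBlock w (ρ x) (σ x) → InBlock w (ρ y) (σ y) →
               ρ′ x ≡ blockStart w (ρ x) + σ x → ρ′ y ≡ blockStart w (ρ y) + σ y →
               Sat (concatMap L w) ρ′ (betF c x y) ⇔ Sat w ρ (pullback (betF c x y) σ)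
    sat-betF {ρ′} {ρ} {σ} c x y inX inY eqX eqY = begin
      (∃[ m ] (Between (ρ′ x) (ρ′ y) m × A m))
        ≈⟨ resp₂-⇔ (λ i j → ∃[ m ] (Between i j m × A m)) eqX eqY ⟩
      (∃[ m ] (Between X Y m × A m))
        ≈⟨ ∃-Between-⇔ ⟩
      (∃[ m ] ((X < m × m < Y) × A m) ⊎ ∃[ m ] ((Y < m × m < X) × A m))
        ≈⟨ ∃-between⇔occursBetween w c inX inY ⊎-⇔ ∃-between⇔occursBetween w c inY inX ⟩
      (OccursBetween c w (ρ x) (σ x) (ρ y) (σ y) ⊎ OccursBetween c w (ρ y) (σ y) (ρ x) (σ x))
        ≈⟨ ⇔-sym (sat-between c x y (σ x) (σ y) ⊎-⇔ sat-between c y x (σ y) (σ x)) ⟩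
      Sat w ρ (pullback (betF c x y) σ) ∎
      where
        open ⇔-Reasoning
        A = λ m → at (concatMap L w) m ≡ just c
        X = blockStart w (ρ x) + σ x
        Y = blockStart w (ρ y) + σ y

    Encodes : Assignment → Assignment → Assignment → Set
    Encodes ρ′ ρ σ = ∀ u → ρ′ u ≡ blockStart w (ρ u) + σ u

    InBlocks : Formula a → Assignment → Assignment → Set
    InBlocks φ ρ σ = ∀ u → Free u φ → InBlock w (ρ u) (σ u)

    encodes-update : ∀ {ρ′ ρ σ} → Encodes ρ′ ρ σ → ∀ v p o →
                     Encodes (update ρ′ v (blockStart w p + o)) (update ρ v p) (update σ v o)
    encodes-update H vx p o vx = refl
    encodes-update H vx p o vy = H vy
    encodes-update H vy p o vx = H vx
    encodes-update H vy p o vy = refl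

    inBlocks-update : ∀ {φ ρ σ} v {p o} → (∀ u → ¬ v ≡ u → Free u φ → InBlock w (ρ u) (σ u)) →
                      InBlock w p o → InBlocks φ (update ρ v p) (update σ v o)
    inBlocks-update vx V inP vx _  = inP
    inBlocks-update vx V inP vy fr = V vy (λ ()) fr
    inBlocks-update vy V inP vx fr = V vx (λ ()) fr
    inBlocks-update vy V inP vy _  = inP

    sat-pullback : ∀ φ {ρ σ ρ′} → InBlocks φ ρ σ → Encodes ρ′ ρ σ →
                   Sat (concatMap L w) ρ′ φ ⇔ Sat w ρ (pullback φ σ)
    sat-pullback (eqF x y) {ρ} {σ} {ρ′} V H = begin
      ρ′ x ≡ ρ′ y
        ≈⟨ resp₂-⇔ _≡_ (H x) (H y) ⟩
      blockStart w (ρ x) + σ x ≡ blockStart w (ρ y) + σ y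
        ≈⟨ blockStart-≡-⇔ w (V x eqˡ) (V y eqʳ) ⟩
      (ρ x ≡ ρ y × σ x ≡ σ y)
        ≈⟨ ⇔-refl ×-⇔ ⇔-sym (sat-decF (σ x ≟ σ y)) ⟩
      Sat w ρ (pullback (eqF x y) σ) ∎
      where open ⇔-Reasoning
    sat-pullback (ltF x y) {ρ} {σ} {ρ′} V H = begin
      ρ′ x < ρ′ y
        ≈⟨ resp₂-⇔ _<_ (H x) (H y) ⟩
      blockStart w (ρ x) + σ x < blockStart w (ρ y) + σ y
        ≈⟨ blockStart-<-⇔ w (V x ltˡ) (V y ltʳ) ⟩
      (ρ x , σ x) <ₗ (ρ y , σ y)
        ≈⟨ ⇔-refl ⊎-⇔ (⇔-refl ×-⇔ ⇔-sym (sat-decF (σ x <? σ y))) ⟩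
      Sat w ρ (pullback (ltF x y) σ) ∎
      where open ⇔-Reasoning
    sat-pullback (letF c x) {ρ} {σ} {ρ′} V H = begin
      at (concatMap L w) (ρ′ x) ≡ just c
        ≈⟨ resp-⇔ (λ i → at (concatMap L w) i ≡ just c) (H x) ⟩
      at (concatMap L w) (blockStart w (ρ x) + σ x) ≡ just c
        ≈⟨ at-concatMap-⇔ w c (V x let₁) ⟩
      (∃[ β ] (at w (ρ x) ≡ just β × Occurs c β (_≡ σ x)))
        ≈⟨ ⇔-sym (sat-someBlock _) ⟩
      Sat w ρ (pullback (letF c x) σ) ∎
      where open ⇔-Reasoning
    sat-pullback (betF c x y) V H = sat-betF c x y (V x betˡ) (V y betʳ) (H x) (H y)
    sat-pullback (notF φ)     V H = ¬-cong-⇔ (sat-pullback φ (λ u → V u ∘ not₁) H)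
    sat-pullback (andF φ ψ)   V H =
      sat-pullback φ (λ u → V u ∘ andˡ) H ×-⇔ sat-pullback ψ (λ u → V u ∘ andʳ) H
    sat-pullback (orF φ ψ)    V H =
      sat-pullback φ (λ u → V u ∘ orˡ) H ⊎-⇔ sat-pullback ψ (λ u → V u ∘ orʳ) H
    sat-pullback (exF v φ)    V H = sat-exF v φ _ λ p o inP →
      sat-pullback φ (inBlocks-update v (λ u v≢u → V u ∘ ex₁ v≢u) inP) (encodes-update H v p o)
    sat-pullback (allF v φ)   V H = sat-allF v φ _ λ p o inP →
      sat-pullback φ (inBlocks-update v (λ u v≢u → V u ∘ all₁ v≢u) inP) (encodes-update H v p o)

  ⊨-pullback : ∀ w {φ} → Sentence φ → (concatMap L w ⊨ φ) ⇔ (w ⊨ pullback φ (λ _ → 0))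
  ⊨-pullback w {φ} closed =
    sat-pullback w φ (λ u fr → ⊥-elim (closed u fr)) (λ _ → sym (trans (+-identityʳ _) (blockStart-zero w)))

  ≡ₖ-concatMap : ∀ {k w₁ w₂} → w₁ ≡[ k ] w₂ → concatMap L w₁ ≡[ k ] concatMap L w₂
  ≡ₖ-concatMap {w₁ = w₁} {w₂} w₁≡w₂ φ closed depth = begin
    concatMap L w₁ ⊨ φ    ≈⟨ ⊨-pullback w₁ closed ⟩
    w₁ ⊨ pullback φ σ₀    ≈⟨ w₁≡w₂ (pullback φ σ₀) (sentence-pullback σ₀ closed) (≤-trans (qd-pullback φ σ₀) depth) ⟩
    w₂ ⊨ pullback φ σ₀    ≈⟨ ⇔-sym (⊨-pullback w₂ closed) ⟩
    concatMap L w₂ ⊨ φ    ∎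
    where
      open ⇔-Reasoning
      σ₀ : Assignment
      σ₀ = λ _ → 0

hom≗concatMap : ∀ {a b} (f : Word b → Word a) → IsMonoidHom f →
                ∀ w → f w ≡ concatMap (λ β → f (β ∷ [])) w
hom≗concatMap f (f[]≡[] , _)    []      = f[]≡[]
hom≗concatMap f hom@(_ , f-++)  (β ∷ w) =
  trans (f-++ (β ∷ []) w) (cong (f (β ∷ []) ++_) (hom≗concatMap f hom w))

lemma6p4 : (k a b : ℕ) (f : Word b → Word a) → IsMonoidHom f →
    (w₁ w₂ : Word b) → w₁ ≡[ k ] w₂ → f w₁ ≡[ k ] f w₂
lemma6p4 k a b f hom w₁ w₂ w₁≡w₂ =
  subst₂ (_≡[ k ]_) (sym (hom≗concatMap f hom w₁)) (sym (hom≗concatMap f hom w₂))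
    (Pullback.≡ₖ-concatMap (λ β → f (β ∷ [])) w₁≡w₂)
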